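{- Let $\Sigma$ be an ordered alphabet and $w\in\Sigma^n$ self-minimal. Then $\mathcal{C}(w)=\{x\in\Sigma^n : x^2\in L(w)\}$.
   Context: $\langle x\rangle$ is the lexicographically minimal cyclic rotation of $x$; $w$ is self-minimal if $\langle w\rangle=w$; $\mathcal{C}(w)=\{x\in\Sigma^{n}:\langle x\rangle\le w\}$. $w_{(i)}$ is the length-$i$ prefix of $w$ and $w[i]$ its $i$-th letter. $\mathrm{Pref}_-(w)=\{w_{(i)}s : 0\le i\le n-1,\ s\in\Sigma,\ s<w[i+1]\}\cup\{w\}$, and $L(w)$ is the set of words over $\Sigma$ having a factor belonging to $\mathrm{Pref}_-(w)$. -}

module Defs where

open import Level using (Level)
open import Data.Nat using (ℕ)
open import Data.Bool using (Bool; true; false)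
open import Data.List using (List; []; _∷_; _++_; [_]; take; drop; length; map; foldr; upTo)
open import Data.Product using (∃; ∃-syntax; _×_; _,_)
open import Data.Sum using (_⊎_)
open import Relation.Binary.Core using (Rel)
open import Relation.Binary.Definitions using (tri<; tri≈; tri>)
open import Relation.Binary.Structures using (IsStrictTotalOrder)
open import Relation.Binary.PropositionalEquality using (_≡_)

module Words {a ℓ : Level} {A : Set a} (_<_ : Rel A ℓ)
             (sto : IsStrictTotalOrder _≡_ _<_) where

  open IsStrictTotalOrder sto using (compare)

  data Lex≤ : List A → List A → Set (Level._⊔_ a ℓ) where
    nil : ∀ {ys} → Lex≤ [] ys
    lt  : ∀ {x y xs ys} → x < y → Lex≤ (x ∷ xs) (y ∷ ys)
    eq  : ∀ {x xs ys} → Lex≤ xs ys → Lex≤ (x ∷ xs) (x ∷ ys)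

  lex≤? : List A → List A → Bool
  lex≤? [] ys = true
  lex≤? (x ∷ xs) [] = false
  lex≤? (x ∷ xs) (y ∷ ys) with compare x y
  ... | tri< _ _ _ = true
  ... | tri≈ _ _ _ = lex≤? xs ys
  ... | tri> _ _ _ = false

  lexMin : List A → List A → List A
  lexMin u v with lex≤? u v
  ... | true  = u
  ... | false = v

  rotate : ℕ → List A → List A
  rotate i x = drop i x ++ take i x

  rotations : List A → List (List A)
  rotations x = map (λ i → rotate i x) (upTo (length x))

  minRot : List A → List A
  minRot x = foldr lexMin x (rotations x)

  SelfMinimal : List A → Set a
  SelfMinimal w = minRot w ≡ w

  -- x ∈ C(w)  (for x of the same length as w):  ⟨x⟩ ≤ w.
  InC : List A → List A → Set (Level._⊔_ a ℓ)
  InC w x = Lex≤ (minRot x) w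

  InPref₋ : List A → List A → Set (Level._⊔_ a ℓ)
  InPref₋ w p = (p ≡ w) ⊎
    (∃[ u ] ∃[ b ] ∃[ v ] ∃[ s ] (w ≡ u ++ b ∷ v × s < b × p ≡ u ++ [ s ]))

  HasFactor : List A → List A → Set a
  HasFactor y p = ∃[ u ] ∃[ v ] (y ≡ u ++ p ++ v)

  InL : List A → List A → Set (Level._⊔_ a ℓ)
  InL w y = ∃[ p ] (InPref₋ w p × HasFactor y p)

module Submission where

-- The rotations of x are exactly the length-|x| factors of x² that
-- start in the first period, and ⟨x⟩ is the least of them.  On the other
-- side, a word m of length |w| satisfies m ≤ w iff some element of Pref₋(w)
-- is a prefix of m.  Hence ⟨x⟩ ≤ w iff some rotation of x starts with an
-- element of Pref₋(w) iff x² has a factor in Pref₋(w); the last step uses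
-- that every factor of x² of length ≤ |x| is a prefix of a rotation of x.

open import Defs
open import Level using (Level)
open import Data.List using (List; []; _∷_; _++_; [_]; length; take; drop; foldr)
open import Data.List.Properties
  using (length-++; length-++-comm; length-++-≤ˡ; ++-assoc; ++-identityʳ; ++-cancelˡ; take++drop≡id; ∷-injective)
open import Data.List.Membership.Propositional using (_∈_)
open import Data.List.Membership.Propositional.Properties using (∈-map⁻; ∈-map⁺; ∈-upTo⁺)
open import Data.List.Relation.Unary.Any using (here; there)
open import Data.Nat using (ℕ; _≤_; _<_; s≤s; z≤n)
open import Data.Nat.Properties using (≤-refl; ≤-trans; ≤-reflexive; m<m+n; suc-injective; _≤?_; ≰⇒>; <⇒≤)
open import Data.Bool using (true; false)
open import Data.Product using (∃-syntax; _×_; _,_)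
open import Data.Sum using (_⊎_; inj₁; inj₂)
open import Function.Bundles using (_⇔_; mk⇔)
open import Relation.Nullary using (yes; no)
open import Relation.Binary.Core using (Rel)
open import Relation.Binary.Definitions using (tri<; tri≈; tri>)
open import Relation.Binary.Structures using (IsStrictTotalOrder)
open import Relation.Binary.PropositionalEquality using (_≡_; refl; sym; trans; cong; cong₂; subst; module ≡-Reasoning)

module ListFacts {a : Level} {A : Set a} where

  ++-prefix : ∀ (xs ys us vs : List A) → xs ++ ys ≡ us ++ vs →
              length xs ≤ length us → ∃[ zs ] (us ≡ xs ++ zs)
  ++-prefix []       ys us       vs e _         = us , refl
  ++-prefix (x ∷ xs) ys (u ∷ us) vs e (s≤s le) with ∷-injective e
  ... | refl , e′ with ++-prefix xs ys us vs e′ le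
  ...   | zs , refl = zs , refl

  ++-length-id : ∀ (xs ys : List A) → length (xs ++ ys) ≡ length xs → ys ≡ []
  ++-length-id []       []      _ = refl
  ++-length-id []       (_ ∷ _) ()
  ++-length-id (x ∷ xs) ys      e = ++-length-id xs ys (suc-injective e)

  take-++-length : ∀ (us vs : List A) → take (length us) (us ++ vs) ≡ us
  take-++-length []       vs = refl
  take-++-length (u ∷ us) vs = cong (u ∷_) (take-++-length us vs)

  drop-++-length : ∀ (us vs : List A) → drop (length us) (us ++ vs) ≡ vs
  drop-++-length []       vs = refl
  drop-++-length (u ∷ us) vs = drop-++-length us vs

module Proof {a ℓ : Level} {A : Set a} (_≺_ : Rel A ℓ)
             (sto : IsStrictTotalOrder _≡_ _≺_) where
  open Words _≺_ sto
  open ListFacts {A = A}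
  open IsStrictTotalOrder sto using (compare) renaming (trans to ≺-trans)

  Lex-refl : ∀ xs → Lex≤ xs xs
  Lex-refl []       = nil
  Lex-refl (x ∷ xs) = eq (Lex-refl xs)

  Lex-trans : ∀ {xs ys zs} → Lex≤ xs ys → Lex≤ ys zs → Lex≤ xs zs
  Lex-trans nil    _      = nil
  Lex-trans (lt p) (lt q) = lt (≺-trans p q)
  Lex-trans (lt p) (eq _) = lt p
  Lex-trans (eq _) (lt q) = lt q
  Lex-trans (eq p) (eq q) = eq (Lex-trans p q)

  lex≤?-true : ∀ u v → lex≤? u v ≡ true → Lex≤ u v
  lex≤?-true []      v       _ = nil
  lex≤?-true (x ∷ u) []      ()
  lex≤?-true (x ∷ u) (y ∷ v) e with compare x y
  ... | tri< p _ _    = lt p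
  ... | tri≈ _ refl _ = eq (lex≤?-true u v e)
  lex≤?-true (x ∷ u) (y ∷ v) () | tri> _ _ _

  lex≤?-false : ∀ u v → lex≤? u v ≡ false → Lex≤ v u
  lex≤?-false []      v       ()
  lex≤?-false (x ∷ u) []      _ = nil
  lex≤?-false (x ∷ u) (y ∷ v) e with compare x y
  lex≤?-false (x ∷ u) (y ∷ v) () | tri< _ _ _
  ... | tri≈ _ refl _ = eq (lex≤?-false u v e)
  ... | tri> _ _ p    = lt p

  lexMin-≤ˡ : ∀ u v → Lex≤ (lexMin u v) u
  lexMin-≤ˡ u v with lex≤? u v in e
  ... | true  = Lex-refl u
  ... | false = lex≤?-false u v e

  lexMin-≤ʳ : ∀ u v → Lex≤ (lexMin u v) v
  lexMin-≤ʳ u v with lex≤? u v in e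
  ... | true  = lex≤?-true u v e
  ... | false = Lex-refl v

  lexMin-choice : ∀ u v → (lexMin u v ≡ u) ⊎ (lexMin u v ≡ v)
  lexMin-choice u v with lex≤? u v
  ... | true  = inj₁ refl
  ... | false = inj₂ refl

  foldMin-≤-seed : ∀ z l → Lex≤ (foldr lexMin z l) z
  foldMin-≤-seed z []      = Lex-refl z
  foldMin-≤-seed z (y ∷ l) = Lex-trans (lexMin-≤ʳ y _) (foldMin-≤-seed z l)

  foldMin-≤-member : ∀ z l {y} → y ∈ l → Lex≤ (foldr lexMin z l) y
  foldMin-≤-member z (y ∷ l) (here refl) = lexMin-≤ˡ y _
  foldMin-≤-member z (y ∷ l) (there m)   = Lex-trans (lexMin-≤ʳ y _) (foldMin-≤-member z l m)

  foldMin-attained : ∀ z l → (foldr lexMin z l ≡ z) ⊎ (foldr lexMin z l ∈ l)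
  foldMin-attained z []      = inj₁ refl
  foldMin-attained z (y ∷ l) with lexMin-choice y (foldr lexMin z l)
  ... | inj₁ e rewrite e = inj₂ (here refl)
  ... | inj₂ e rewrite e with foldMin-attained z l
  ...   | inj₁ e′ = inj₁ e′
  ...   | inj₂ m  = inj₂ (there m)

  IsRotation : List A → List A → Set a
  IsRotation r x = ∃[ u ] ∃[ v ] (x ≡ u ++ v × r ≡ v ++ u)

  rotation-length : ∀ {r x} → IsRotation r x → length r ≡ length x
  rotation-length (u , v , refl , refl) = length-++-comm v u

  rotate-isRotation : ∀ i x → IsRotation (rotate i x) x
  rotate-isRotation i x = take i x , drop i x , sym (take++drop≡id i x) , refl

  minRot-isRotation : ∀ x → IsRotation (minRot x) x
  minRot-isRotation x with foldMin-attained x (rotations x)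
  ... | inj₁ e = [] , x , refl , trans e (sym (++-identityʳ x))
  ... | inj₂ m with ∈-map⁻ (λ i → rotate i x) m
  ...   | i , _ , e = subst (λ r → IsRotation r x) (sym e) (rotate-isRotation i x)

  -- ⟨x⟩ is below every rotation of x: a rotation v u with v ≠ [] is
  -- listed in `rotations x`, and u itself (v = []) is the seed x.
  minRot-≤-rotation : ∀ {r x} → IsRotation r x → Lex≤ (minRot x) r
  minRot-≤-rotation {x = x} (u , [] , refl , refl) =
    subst (Lex≤ (minRot x)) (++-identityʳ u) (foldMin-≤-seed x (rotations x))
  minRot-≤-rotation {x = x} (u , c ∷ v , refl , refl) =
    subst (Lex≤ (minRot x)) rotate-u (foldMin-≤-member x (rotations x) listed)
    where
    u<x : length u < length x
    u<x = subst (length u <_) (sym (length-++ u)) (m<m+n (length u) (s≤s z≤n))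
    listed : rotate (length u) x ∈ rotations x
    listed = ∈-map⁺ (λ i → rotate i x) (∈-upTo⁺ u<x)
    rotate-u : rotate (length u) x ≡ (c ∷ v) ++ u
    rotate-u = cong₂ _++_ (drop-++-length u (c ∷ v)) (take-++-length u (c ∷ v))

  rotation-factor : ∀ {r x} → IsRotation r x → HasFactor (x ++ x) r
  rotation-factor (u , v , refl , refl) = u , v , (begin
      (u ++ v) ++ u ++ v   ≡⟨ ++-assoc u v (u ++ v) ⟩
      u ++ v ++ u ++ v     ≡⟨ cong (u ++_) (sym (++-assoc v u v)) ⟩
      u ++ (v ++ u) ++ v   ∎)
    where open ≡-Reasoning

  occurrence-in-first-period : ∀ (x α q β : List A) → x ++ x ≡ α ++ q ++ β →
    ∃[ α′ ] ∃[ β′ ] (length α′ ≤ length x × x ++ x ≡ α′ ++ q ++ β′)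
  occurrence-in-first-period x α q β e with length α ≤? length x
  ... | yes le = α , β , le , e
  ... | no  gt with ++-prefix x x α (q ++ β) e (<⇒≤ (≰⇒> gt))
  ...   | α′ , refl = α′ , β ++ x , within , (begin
      x ++ x                 ≡⟨ cong (_++ x) second-copy ⟩
      (α′ ++ q ++ β) ++ x    ≡⟨ ++-assoc α′ (q ++ β) x ⟩
      α′ ++ (q ++ β) ++ x    ≡⟨ cong (α′ ++_) (++-assoc q β x) ⟩
      α′ ++ q ++ β ++ x      ∎)
    where
    open ≡-Reasoning
    second-copy : x ≡ α′ ++ q ++ β
    second-copy = ++-cancelˡ x x (α′ ++ q ++ β) (trans e (++-assoc x α′ (q ++ β)))
    within : length α′ ≤ length x
    within = subst (length α′ ≤_) (cong length (sym second-copy)) (length-++-≤ˡ α′)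

  -- A factor of x² of length ≤ |x| is a prefix of some rotation of x: with
  -- the occurrence at α in the first period, x = α δ, the factor starts the
  -- suffix δ α δ of x², and being short it is a prefix of the rotation δ α.
  short-factor-in-rotation : ∀ x q → HasFactor (x ++ x) q → length q ≤ length x →
    ∃[ r ] ∃[ γ ] (IsRotation r x × r ≡ q ++ γ)
  short-factor-in-rotation x q (α₀ , β₀ , e₀) q≤x
    with occurrence-in-first-period x α₀ q β₀ e₀
  ... | α , β , α≤x , e with ++-prefix α (q ++ β) x x (sym e) α≤x
  ...   | δ , refl with ++-prefix q β (δ ++ α) δ tail (subst (length q ≤_) (length-++-comm α δ) q≤x)
    where
    tail : q ++ β ≡ (δ ++ α) ++ δ
    tail = sym (++-cancelˡ α ((δ ++ α) ++ δ) (q ++ β)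
      (trans (cong (α ++_) (++-assoc δ α δ)) (trans (sym (++-assoc α δ (α ++ δ))) e)))
  ...     | γ , δα≡qγ = δ ++ α , γ , (α , δ , refl , refl) , δα≡qγ

  Pref₋-cons : ∀ {c w p} → InPref₋ w p → InPref₋ (c ∷ w) (c ∷ p)
  Pref₋-cons {c} (inj₁ e) = inj₁ (cong (c ∷_) e)
  Pref₋-cons {c} (inj₂ (u , b , v , s , we , s≺b , pe)) =
    inj₂ (c ∷ u , b , v , s , cong (c ∷_) we , s≺b , cong (c ∷_) pe)

  Pref₋-length : ∀ {w p} → InPref₋ w p → length p ≤ length w
  Pref₋-length (inj₁ refl) = ≤-refl
  Pref₋-length (inj₂ (u , b , v , s , refl , _ , refl)) = shorter u
    where
    shorter : ∀ u → length (u ++ [ s ]) ≤ length (u ++ b ∷ v)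
    shorter []      = s≤s z≤n
    shorter (c ∷ u) = s≤s (shorter u)

  -- A word m ≤ w of length |w| starts with an element of Pref₋(w): either
  -- m = w, or m and w first differ at a letter where m is smaller.
  ≤⇒Pref₋-prefix : ∀ {m w} → Lex≤ m w → length m ≡ length w →
    ∃[ p ] (InPref₋ w p × ∃[ v ] (m ≡ p ++ v))
  ≤⇒Pref₋-prefix {w = []}    nil _  = [] , inj₁ refl , [] , refl
  ≤⇒Pref₋-prefix {w = _ ∷ _} nil ()
  ≤⇒Pref₋-prefix (lt {x} {y} {xs} {ys} x≺y) _ =
    [ x ] , inj₂ ([] , y , ys , x , refl , x≺y , refl) , xs , refl
  ≤⇒Pref₋-prefix (eq {x} le) l with ≤⇒Pref₋-prefix le (suc-injective l)
  ... | p , pp , v , refl = x ∷ p , Pref₋-cons pp , v , refl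

  Pref₋-prefix⇒≤ : ∀ {w p} γ → InPref₋ w p → length (p ++ γ) ≡ length w → Lex≤ (p ++ γ) w
  Pref₋-prefix⇒≤ {w} γ (inj₁ refl) l
    rewrite ++-length-id w γ l | ++-identityʳ w = Lex-refl w
  Pref₋-prefix⇒≤ γ (inj₂ (u , b , v , s , refl , s≺b , refl)) _ = below u
    where
    below : ∀ u → Lex≤ ((u ++ [ s ]) ++ γ) (u ++ b ∷ v)
    below []      = lt s≺b
    below (c ∷ u) = eq (below u)

  C⊆L : ∀ w x → length x ≡ length w → InC w x → InL w (x ++ x)
  C⊆L w x l ⟨x⟩≤w with ≤⇒Pref₋-prefix ⟨x⟩≤w (trans (rotation-length (minRot-isRotation x)) l)
  ... | p , pp , v , ⟨x⟩≡pv with rotation-factor (minRot-isRotation x)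
  ...   | α , β , e = p , pp , α , v ++ β , (begin
      x ++ x               ≡⟨ e ⟩
      α ++ minRot x ++ β   ≡⟨ cong (λ m → α ++ m ++ β) ⟨x⟩≡pv ⟩
      α ++ (p ++ v) ++ β   ≡⟨ cong (α ++_) (++-assoc p v β) ⟩
      α ++ p ++ v ++ β     ∎)
    where open ≡-Reasoning

  L⊆C : ∀ w x → length x ≡ length w → InL w (x ++ x) → InC w x
  L⊆C w x l (p , pp , occ)
    with short-factor-in-rotation x p occ (≤-trans (Pref₋-length pp) (≤-reflexive (sym l)))
  ... | r , γ , rot , refl =
    Lex-trans (minRot-≤-rotation rot) (Pref₋-prefix⇒≤ γ pp (trans (rotation-length rot) l))

mainTheorem19 : {a ℓ : Level} {A : Set a} (_<_ : Rel A ℓ)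
    (sto : IsStrictTotalOrder _≡_ _<_) (n : ℕ) (w : List A) →
    length w ≡ n → Words.SelfMinimal _<_ sto w →
    (x : List A) → length x ≡ n →
    (Words.InC _<_ sto w x ⇔ Words.InL _<_ sto w (x ++ x))
mainTheorem19 _<_ sto n w lw _ x lx =
  mk⇔ (Proof.C⊆L _<_ sto w x |x|≡|w|) (Proof.L⊆C _<_ sto w x |x|≡|w|)
  where
  |x|≡|w| : length x ≡ length w
  |x|≡|w| = trans lx (sym lw)
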